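{- Let $p\equiv 7\pmod 8$ be a prime and let $\theta=1+\sqrt2$, where $\sqrt2$ is a square root of $2$ in $\mathbb{Z}_{p^2}$. If $\theta$ generates $U(p^2)/\{1,-1\}$, then there exists a PPS$(\mathbb{Z}_{p^2},\{0,\pm1,\pm p\},\{0,\pm(\theta-1),\pm p(\theta-1)\})$.
   Context: $U(p^2)$ is the group of units of $\mathbb{Z}/p^2\mathbb{Z}$. For an abelian group $(G,+)$ and subsets $A_1,A_2\subseteq G$ with $|A_1|=|A_2|$, a PPS$(G,A_1,A_2)$ is a set $\mathcal S$ of $(|G|-|A_1|)/4$ unordered pairs $\{x,y\}$ from $G$ with $\bigcup_{\{x,y\}\in\mathcal S}\pm\{x,y\}=G\setminus A_1$ and $\bigcup_{\{x,y\}\in\mathcal S}\pm\{x-y,x+y\}=G\setminus A_2$. -}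

module Defs where

open import Data.Nat using (ℕ; zero; suc; _+_; _*_; _∸_; _^_; _<_)
open import Data.Nat.DivMod using (_%_)
open import Data.Nat.Properties using (_≟_)
open import Data.Nat.Coprimality using (Coprime)
open import Data.List using (List; []; _∷_; length; filter; upTo)
open import Data.List.Relation.Unary.Any using (Any; any?)
open import Data.List.Relation.Unary.All using (All)
open import Data.Product using (Σ; ∃; _×_; proj₁; proj₂)
open import Data.Sum using (_⊎_)
open import Relation.Nullary using (¬_)
open import Relation.Binary.PropositionalEquality using (_≡_)

-- Arithmetic in ℤ/Nℤ, with residues represented by natural numbers.
-- (For N = 0 the reduction is the identity; we only use N = p*p > 0.)
_mod_ : ℕ → ℕ → ℕ
a mod zero    = a
a mod (suc n) = a % suc n

module ZMod (N : ℕ) where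

  _≡ₘ_ : ℕ → ℕ → Set
  a ≡ₘ b = a mod N ≡ b mod N

  negₘ : ℕ → ℕ
  negₘ a = (N ∸ (a mod N)) mod N

  _+ₘ_ : ℕ → ℕ → ℕ
  a +ₘ b = (a + b) mod N

  _-ₘ_ : ℕ → ℕ → ℕ
  a -ₘ b = (a + negₘ b) mod N

  _*ₘ_ : ℕ → ℕ → ℕ
  a *ₘ b = (a * b) mod N

  _∈ₘ_ : ℕ → List ℕ → Set
  z ∈ₘ A = Any (λ a → a ≡ₘ z) A

  card : List ℕ → ℕ
  card A = length (filter (λ z → any? (λ a → a mod N ≟ z mod N) A) (upTo N))

  ±⟨_,_⟩ : ℕ → ℕ → List ℕ
  ±⟨ x , y ⟩ = x ∷ negₘ x ∷ y ∷ negₘ y ∷ []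

  -- U(N): units of ℤ/Nℤ, represented by 0 ≤ u < N with gcd(u,N)=1.
  -- θ generates U(N)/{1,-1}: every unit is ± a power of θ.
  GeneratesModSign : ℕ → Set
  GeneratesModSign θ = ∀ u → u < N → Coprime u N →
    ∃ λ k → ((θ ^ k) ≡ₘ u) ⊎ ((θ ^ k) ≡ₘ negₘ u)

  -- PPS(ℤ/Nℤ, A₁, A₂): a set S of (N - |A₁|)/4 unordered pairs {x,y}
  -- (represented as a list of ordered pairs of residues) with
  -- ⋃ ±{x,y} = G ∖ A₁ and ⋃ ±{x-y,x+y} = G ∖ A₂ ; |A₁| = |A₂| is required.
  PPS : List ℕ → List ℕ → Set
  PPS A₁ A₂ = (card A₁ ≡ card A₂) × Σ (List (ℕ × ℕ)) λ S →
    (4 * length S + card A₁ ≡ N)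
    × All (λ xy → proj₁ xy < N × proj₂ xy < N) S
    × (∀ z → z < N →
        ((¬ (z ∈ₘ A₁) → Any (λ xy → z ∈ₘ ±⟨ proj₁ xy , proj₂ xy ⟩) S)
        × (Any (λ xy → z ∈ₘ ±⟨ proj₁ xy , proj₂ xy ⟩) S → ¬ (z ∈ₘ A₁))))
    × (∀ z → z < N →
        ((¬ (z ∈ₘ A₂) →
           Any (λ xy → z ∈ₘ ±⟨ proj₁ xy -ₘ proj₂ xy , proj₁ xy +ₘ proj₂ xy ⟩) S)
        × (Any (λ xy → z ∈ₘ ±⟨ proj₁ xy -ₘ proj₂ xy , proj₁ xy +ₘ proj₂ xy ⟩) S
           → ¬ (z ∈ₘ A₂))))

module Submission where

-- Write θ = 1 + s. Since θ (s − 1) = s² − 1 = 1, θ is a unit mod p², and by hypothesis every unit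
-- is ±θᵏ. The nonzero residues mod p² split into the units and the nonzero multiples of p, the
-- orbits of ±θᵏ and of ±pθᵏ. Enumerating both sets (p(p−1) and p−1 elements), two pigeonhole
-- counts show that ±θᵏ has exact period m₁ = p(p−1)/2 and ±pθᵏ exact period m₂ = (p−1)/2. For
-- p ≡ 7 (mod 8) both periods are odd, so the nontrivial elements of the orbit of c ∈ {1, p} pair up
-- as {cθ²ⁱ⁺¹, cθ²ⁱ⁺²}, and these (p² − 5)/4 pairs cover exactly the complement of {0, ±1, ±p}.
-- As (θ − 1)² = 2, consecutive x = cθᵏ, y = cθᵏ⁺¹ satisfy x − y = −s x and x + y = s y, so the pairs
-- {x − y, x + y} cover s times that complement, which is the complement of {0, ±s, ±ps}.

open import Data.Nat as ℕ using (ℕ; zero; suc; _%_; _∸_)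
import Data.Nat.Properties as ℕ
import Data.Nat.Divisibility as ℕ
open import Data.Nat.DivMod
  using (m≡m%n+[m/n]*n; %-remove-+ˡ; %-remove-+ʳ; m<n⇒m%n≡m; m%n≤n; m%n<n; +-distrib-/-∣ˡ; m*n/n≡m;
         m<n⇒m/n≡0; m<n*o⇒m/o<n; m/n*n≡m)
open import Data.Nat.Primality using (Prime; euclidsLemma; prime⇒irreducible; prime⇒nonTrivial)
open import Data.Nat.Coprimality using (Coprime; coprime-divisor)
open import Data.Nat.Tactic.RingSolver renaming (solve-∀ to ℕ-solve-∀)
open import Data.Integer as ℤ using (ℤ; +_; _+_; _*_; -_; _-_; _^_; 0ℤ; 1ℤ)
import Data.Integer.Properties as ℤ
open import Data.Integer.DivMod using (_%ℕ_; _/ℕ_; n%ℕd<d; a≡a%ℕn+[a/ℕn]*n)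
open import Data.Integer.Divisibility.Signed
  using (_∣_; divides; ∣⇒∣ᵤ; ∣ᵤ⇒∣; _∣?_; ∣-refl; ∣-trans; ∣m∣n⇒∣m+n; ∣m∣n⇒∣m-n; ∣m⇒∣-m;
         ∣n⇒∣m*n; ∣m⇒∣m*n)
import Data.Integer.Divisibility as Unsigned
open import Data.Integer.Tactic.RingSolver using (solve-∀)
open import Data.Fin using (Fin; toℕ; fromℕ<; splitAt; join)
import Data.Fin as Fin
open import Data.Fin.Properties using (pigeonhole; toℕ<n; toℕ-injective; toℕ-fromℕ<; join-splitAt; splitAt-join)
import Data.Fin.Properties as Fin
open import Data.List using (List; []; _∷_; _++_; length; map; upTo; filter)
import Data.List.Properties as List
open import Data.List.Membership.Propositional using (_∈_; find; lose)
open import Data.List.Membership.Propositional.Properties using (∈-upTo⁺; ∈-upTo⁻)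
open import Data.List.Relation.Unary.Any as Any using (Any; here; there)
import Data.List.Relation.Unary.Any.Properties as Any
open import Data.List.Relation.Unary.All as All using (All; []; _∷_)
import Data.List.Relation.Unary.All.Properties as All
open import Data.List.Relation.Unary.AllPairs using (AllPairs; []; _∷_)
open import Data.List.Relation.Unary.Unique.Propositional using (Unique)
import Data.List.Relation.Unary.Unique.Propositional.Properties as Unique
open import Data.Product using (Σ; ∃; ∃₂; _×_; _,_; proj₁; proj₂)
open import Data.Sum as Sum using (_⊎_; inj₁; inj₂; [_,_]′)
open import Data.Empty using (⊥-elim)
open import Function using (_∘_; case_of_)
open import Relation.Nullary using (¬_; yes; no)
open import Relation.Nullary.Decidable using (_⊎-dec_)
import Relation.Unary as U
open import Relation.Binary.Bundles using (Setoid)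
open import Relation.Binary.Definitions using (tri<; tri≈; tri>)
open import Relation.Binary.PropositionalEquality
import Relation.Binary.Reasoning.Setoid as SetoidReasoning
open import Defs

module Congruence (n : ℕ) where

  infix 4 _≈_ _≈±_

  -- A record rather than a synonym for divisibility, so that x and y can be inferred from x ≈ y.
  record _≈_ (x y : ℤ) : Set where
    constructor congruent
    field n∣x-y : + n ∣ x - y

  congruent-by : ∀ {x y d} → d ≡ x - y → + n ∣ d → x ≈ y
  congruent-by refl = congruent

  ≈-reflexive : ∀ {x y} → x ≡ y → x ≈ y
  ≈-reflexive {x} refl = congruent (divides 0ℤ (ℤ.+-inverseʳ x))

  ≈-refl : ∀ {x} → x ≈ x
  ≈-refl = ≈-reflexive refl

  ≈-sym : ∀ {x y} → x ≈ y → y ≈ x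
  ≈-sym {x} {y} (congruent n∣x-y) = congruent-by (swap x y) (∣m⇒∣-m n∣x-y)
    where
    swap : ∀ x y → - (x - y) ≡ y - x
    swap = solve-∀

  ≈-trans : ∀ {x y z} → x ≈ y → y ≈ z → x ≈ z
  ≈-trans {x} {y} {z} (congruent n∣x-y) (congruent n∣y-z) =
    congruent-by (telescope x y z) (∣m∣n⇒∣m+n n∣x-y n∣y-z)
    where
    telescope : ∀ x y z → (x - y) + (y - z) ≡ x - z
    telescope = solve-∀

  ≈-setoid : Setoid _ _
  ≈-setoid = record
    { Carrier = ℤ ; _≈_ = _≈_
    ; isEquivalence = record { refl = ≈-refl ; sym = ≈-sym ; trans = ≈-trans } }

  module ≈-Reasoning = SetoidReasoning ≈-setoid

  +-cong : ∀ {x x′ y y′} → x ≈ x′ → y ≈ y′ → x + y ≈ x′ + y′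
  +-cong {x} {x′} {y} {y′} (congruent n∣x-x′) (congruent n∣y-y′) =
    congruent-by (regroup x x′ y y′) (∣m∣n⇒∣m+n n∣x-x′ n∣y-y′)
    where
    regroup : ∀ x x′ y y′ → (x - x′) + (y - y′) ≡ (x + y) - (x′ + y′)
    regroup = solve-∀

  -‿cong : ∀ {x y} → x ≈ y → - x ≈ - y
  -‿cong {x} {y} (congruent n∣x-y) = congruent-by (negate x y) (∣m⇒∣-m n∣x-y)
    where
    negate : ∀ x y → - (x - y) ≡ - x - - y
    negate = solve-∀

  *-cong : ∀ {x x′ y y′} → x ≈ x′ → y ≈ y′ → x * y ≈ x′ * y′
  *-cong {x} {x′} {y} {y′} (congruent n∣x-x′) (congruent n∣y-y′) =
    congruent-by (regroup x x′ y y′) (∣m∣n⇒∣m+n (∣m⇒∣m*n y n∣x-x′) (∣n⇒∣m*n x′ n∣y-y′))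
    where
    regroup : ∀ x x′ y y′ → (x - x′) * y + x′ * (y - y′) ≡ x * y - x′ * y′
    regroup = solve-∀

  ^-cong : ∀ {x y} k → x ≈ y → x ^ k ≈ y ^ k
  ^-cong zero    x≈y = ≈-refl
  ^-cong (suc k) x≈y = *-cong x≈y (^-cong k x≈y)

  -‿injective : ∀ {x y} → - x ≈ - y → x ≈ y
  -‿injective {x} {y} -x≈-y = subst₂ _≈_ (ℤ.neg-involutive x) (ℤ.neg-involutive y) (-‿cong -x≈-y)

  ≈-neg-swap : ∀ {x y} → x ≈ - y → y ≈ - x
  ≈-neg-swap {x} {y} x≈-y = ≈-trans (≈-reflexive (sym (ℤ.neg-involutive y))) (-‿cong (≈-sym x≈-y))

  n≈0 : + n ≈ 0ℤ
  n≈0 = congruent (divides 1ℤ (identity (+ n)))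
    where
    identity : ∀ x → x - 0ℤ ≡ 1ℤ * x
    identity = solve-∀

  +-multiple≈ : ∀ x k → x + k * + n ≈ x
  +-multiple≈ x k = congruent (divides k (cancel x (k * + n)))
    where
    cancel : ∀ x y → x + y - x ≡ y
    cancel = solve-∀

  inverse-cancel : ∀ u u⁻¹ x → u * u⁻¹ ≈ 1ℤ → u⁻¹ * (u * x) ≈ x
  inverse-cancel u u⁻¹ x uu⁻¹≈1 = begin
    u⁻¹ * (u * x)  ≡⟨ regroup u u⁻¹ x ⟩
    u * u⁻¹ * x    ≈⟨ *-cong uu⁻¹≈1 ≈-refl ⟩
    1ℤ * x         ≡⟨ ℤ.*-identityˡ x ⟩
    x              ∎
    where
    open ≈-Reasoning
    regroup : ∀ u u⁻¹ x → u⁻¹ * (u * x) ≡ u * u⁻¹ * x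
    regroup = solve-∀

  self-negative⇒≈0 : ∀ {h x} → + 2 * h ≈ 1ℤ → x ≈ - x → x ≈ 0ℤ
  self-negative⇒≈0 {h} {x} 2h≈1 x≈-x = begin
    x              ≡⟨ ℤ.*-identityˡ x ⟨
    1ℤ * x         ≈⟨ *-cong (≈-sym 2h≈1) ≈-refl ⟩
    + 2 * h * x    ≡⟨ regroup h x ⟩
    h * (x + x)    ≈⟨ *-cong (≈-refl {h}) (+-cong (≈-refl {x}) x≈-x) ⟩
    h * (x - x)    ≡⟨ cancel h x ⟩
    0ℤ             ∎
    where
    open ≈-Reasoning
    regroup : ∀ h x → + 2 * h * x ≡ h * (x + x)
    regroup = solve-∀
    cancel : ∀ h x → h * (x - x) ≡ 0ℤ
    cancel = solve-∀

  _≈±_ : ℤ → ℤ → Set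
  x ≈± y = x ≈ y ⊎ x ≈ - y

  ≈±-reflexive : ∀ {x y} → x ≡ y → x ≈± y
  ≈±-reflexive x≡y = inj₁ (≈-reflexive x≡y)

  ≈±-sym : ∀ {x y} → x ≈± y → y ≈± x
  ≈±-sym = Sum.map ≈-sym ≈-neg-swap

  ≈±-trans : ∀ {x y z} → x ≈± y → y ≈± z → x ≈± z
  ≈±-trans (inj₁ x≈y)  (inj₁ y≈z)  = inj₁ (≈-trans x≈y y≈z)
  ≈±-trans (inj₁ x≈y)  (inj₂ y≈-z) = inj₂ (≈-trans x≈y y≈-z)
  ≈±-trans (inj₂ x≈-y) (inj₁ y≈z)  = inj₂ (≈-trans x≈-y (-‿cong y≈z))
  ≈±-trans {z = z} (inj₂ x≈-y) (inj₂ y≈-z) =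
    inj₁ (≈-trans x≈-y (≈-trans (-‿cong y≈-z) (≈-reflexive (ℤ.neg-involutive z))))

  ≈±-cong : ∀ {x x′ y y′} → x ≈ x′ → y ≈ y′ → x ≈± y → x′ ≈± y′
  ≈±-cong x≈x′ y≈y′ = Sum.map (λ x≈y → ≈-trans (≈-sym x≈x′) (≈-trans x≈y y≈y′))
                              (λ x≈-y → ≈-trans (≈-sym x≈x′) (≈-trans x≈-y (-‿cong y≈y′)))

  *-congˡ-≈± : ∀ u {x y} → x ≈± y → u * x ≈± u * y
  *-congˡ-≈± u {y = y} = Sum.map (*-cong (≈-refl {u}))
    (λ x≈-y → ≈-trans (*-cong (≈-refl {u}) x≈-y) (≈-reflexive (sym (ℤ.neg-distribʳ-* u y))))

  *-cancelˡ-≈± : ∀ u u⁻¹ {x y} → u * u⁻¹ ≈ 1ℤ → u * x ≈± u * y → x ≈± y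
  *-cancelˡ-≈± u u⁻¹ {x} {y} uu⁻¹≈1 ux≈±uy =
    ≈±-cong (inverse-cancel u u⁻¹ x uu⁻¹≈1) (inverse-cancel u u⁻¹ y uu⁻¹≈1) (*-congˡ-≈± u⁻¹ ux≈±uy)

pos-^ : ∀ a k → + (a ℕ.^ k) ≡ (+ a) ^ k
pos-^ a zero    = refl
pos-^ a (suc k) = trans (ℤ.pos-* a (a ℕ.^ k)) (cong (+ a *_) (pos-^ a k))

mod≡% : ∀ a N .{{_ : ℕ.NonZero N}} → a mod N ≡ a % N
mod≡% a (suc n) = refl

module Residues (N : ℕ) .{{_ : ℕ.NonZero N}} where

  open Congruence N
  open ZMod N using (negₘ; _≡ₘ_; _+ₘ_; _-ₘ_)

  %-≈ : ∀ a → + (a % N) ≈ + a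
  %-≈ a = ≈-sym (subst (_≈ + (a % N)) (sym +a≡) (+-multiple≈ (+ (a % N)) (+ (a ℕ./ N))))
    where
    +a≡ : + a ≡ + (a % N) + + (a ℕ./ N) * + N
    +a≡ = begin
      + a                              ≡⟨ cong +_ (m≡m%n+[m/n]*n a N) ⟩
      + (a % N ℕ.+ a ℕ./ N ℕ.* N)      ≡⟨ ℤ.pos-+ (a % N) _ ⟩
      + (a % N) + + (a ℕ./ N ℕ.* N)    ≡⟨ cong (_+_ (+ (a % N))) (ℤ.pos-* (a ℕ./ N) N) ⟩
      + (a % N) + + (a ℕ./ N) * + N    ∎
      where open ≡-Reasoning

  mod-≈ : ∀ a → + (a mod N) ≈ + a
  mod-≈ a = subst (λ r → + r ≈ + a) (sym (mod≡% a N)) (%-≈ a)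

  ≈⇒N∣∸ : ∀ {a b} → b ℕ.≤ a → + a ≈ + b → N ℕ.∣ a ∸ b
  ≈⇒N∣∸ {a} {b} b≤a (congruent N∣a-b) =
    subst (N ℕ.∣_) (cong ℤ.∣_∣ (trans (ℤ.m-n≡m⊖n a b) (ℤ.⊖-≥ b≤a))) (∣⇒∣ᵤ N∣a-b)

  ≥-≈⇒%≡ : ∀ {a b} → b ℕ.≤ a → + a ≈ + b → a % N ≡ b % N
  ≥-≈⇒%≡ {a} {b} b≤a a≈b =
    trans (cong (_% N) (sym (ℕ.m+[n∸m]≡n b≤a))) (%-remove-+ʳ b (≈⇒N∣∸ b≤a a≈b))

  ≈⇒%≡ : ∀ {a b} → + a ≈ + b → a % N ≡ b % N
  ≈⇒%≡ {a} {b} a≈b with ℕ.≤-total b a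
  ... | inj₁ b≤a = ≥-≈⇒%≡ b≤a a≈b
  ... | inj₂ a≤b = sym (≥-≈⇒%≡ a≤b (≈-sym a≈b))

  ≡ₘ⇒≈ : ∀ {a b} → a ≡ₘ b → + a ≈ + b
  ≡ₘ⇒≈ {a} {b} a≡ₘb = begin
    + a              ≈⟨ ≈-sym (mod-≈ a) ⟩
    + (a mod N)      ≡⟨ cong +_ a≡ₘb ⟩
    + (b mod N)      ≈⟨ mod-≈ b ⟩
    + b              ∎
    where open ≈-Reasoning

  ≈⇒≡ₘ : ∀ {a b} → + a ≈ + b → a ≡ₘ b
  ≈⇒≡ₘ {a} {b} a≈b = trans (mod≡% a N) (trans (≈⇒%≡ a≈b) (sym (mod≡% b N)))

  ≈-<-injective : ∀ {a b} → a ℕ.< N → b ℕ.< N → + a ≈ + b → a ≡ b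
  ≈-<-injective a<N b<N a≈b = trans (sym (m<n⇒m%n≡m a<N)) (trans (≈⇒%≡ a≈b) (m<n⇒m%n≡m b<N))

  negₘ-≈ : ∀ a → + negₘ a ≈ - + a
  negₘ-≈ a = begin
    + negₘ a             ≈⟨ mod-≈ (N ∸ a mod N) ⟩
    + (N ∸ a mod N)      ≡⟨ trans (ℤ.m-n≡m⊖n N (a mod N)) (ℤ.⊖-≥ a%N≤N) ⟨
    + N - + (a mod N)    ≈⟨ +-cong n≈0 (-‿cong (mod-≈ a)) ⟩
    0ℤ - + a             ≡⟨ ℤ.+-identityˡ (- + a) ⟩
    - + a                ∎
    where
    open ≈-Reasoning
    a%N≤N : a mod N ℕ.≤ N
    a%N≤N = subst (ℕ._≤ N) (sym (mod≡% a N)) (m%n≤n a N)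

  +ₘ-≈ : ∀ a b → + (a +ₘ b) ≈ + a + + b
  +ₘ-≈ a b = ≈-trans (mod-≈ (a ℕ.+ b)) (≈-reflexive (ℤ.pos-+ a b))

  -ₘ-≈ : ∀ a b → + (a -ₘ b) ≈ + a - + b
  -ₘ-≈ a b = ≈-trans (+ₘ-≈ a (negₘ b)) (+-cong (≈-refl {+ a}) (negₘ-≈ b))

  residue : ℤ → ℕ
  residue x = x %ℕ N

  residue-< : ∀ x → residue x ℕ.< N
  residue-< x = n%ℕd<d x N

  residue-≈ : ∀ x → + residue x ≈ x
  residue-≈ x = ≈-sym (subst (_≈ + residue x) (sym (a≡a%ℕn+[a/ℕn]*n x N)) (+-multiple≈ _ (x /ℕ N)))

  residue-≡⇒≈ : ∀ {x y} → residue x ≡ residue y → x ≈ y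
  residue-≡⇒≈ {x} {y} rx≡ry =
    ≈-trans (≈-sym (residue-≈ x)) (≈-trans (≈-reflexive (cong +_ rx≡ry)) (residue-≈ y))

module Orbit (N : ℕ) (c θ θ⁻¹ : ℤ) (θθ⁻¹≈1 : Congruence._≈_ N (θ * θ⁻¹) 1ℤ) where

  open Congruence N

  orbit : ℕ → ℤ
  orbit k = c * θ ^ k

  orbit-+ : ∀ a b → orbit (a ℕ.+ b) ≡ θ ^ a * orbit b
  orbit-+ a b = trans (cong (c *_) (ℤ.^-distribˡ-+-* θ a b)) (swap c (θ ^ a) (θ ^ b))
    where
    swap : ∀ c x y → c * (x * y) ≡ x * (c * y)
    swap = solve-∀

  θ^-cancel : ∀ a {x y} → θ ^ a * x ≈± θ ^ a * y → x ≈± y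
  θ^-cancel zero    {x} {y} = ≈±-cong (≈-reflexive (ℤ.*-identityˡ x)) (≈-reflexive (ℤ.*-identityˡ y))
  θ^-cancel (suc a) {x} {y} θ^ax≈±θ^ay = θ^-cancel a (*-cancelˡ-≈± θ θ⁻¹ θθ⁻¹≈1
    (subst₂ _≈±_ (ℤ.*-assoc θ (θ ^ a) x) (ℤ.*-assoc θ (θ ^ a) y) θ^ax≈±θ^ay))

  orbit-cancel : ∀ a t → orbit a ≈± orbit (a ℕ.+ t) → c ≈± orbit t
  orbit-cancel a t = θ^-cancel a ∘ subst₂ _≈±_ (ℤ.*-comm c (θ ^ a)) (orbit-+ a t)

  periodic : ∀ {t} → orbit t ≈± c → ∀ q r → orbit (r ℕ.+ q ℕ.* t) ≈± orbit r
  periodic period zero    r = ≈±-reflexive (cong orbit (ℕ.+-identityʳ r))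
  periodic {t} period (suc q) r = ≈±-trans one-period (periodic period q r)
    where
    k = r ℕ.+ q ℕ.* t
    exponents : ∀ r t q → r ℕ.+ q ℕ.* t ℕ.+ t ≡ r ℕ.+ (t ℕ.+ q ℕ.* t)
    exponents = ℕ-solve-∀
    one-period : orbit (r ℕ.+ (t ℕ.+ q ℕ.* t)) ≈± orbit k
    one-period = subst₂ _≈±_ (trans (sym (orbit-+ k t)) (cong orbit (exponents r t q)))
                             (ℤ.*-comm (θ ^ k) c) (*-congˡ-≈± (θ ^ k) period)

  orbit-mod-period : ∀ {t} .{{_ : ℕ.NonZero t}} → orbit t ≈± c → ∀ k → orbit k ≈± orbit (k % t)
  orbit-mod-period {t} period k =
    subst (λ e → orbit e ≈± orbit (k % t)) (sym (m≡m%n+[m/n]*n k t)) (periodic period (k ℕ./ t) (k % t))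

record Enumeration (N : ℕ) (Cl : ℤ → Set) (n : ℕ) : Set where
  field
    index             : ∀ z → z ℕ.< N → Cl (+ z) → Fin n
    element           : Fin n → ℕ
    element-<         : ∀ i → element i ℕ.< N
    element-∈         : ∀ i → Cl (+ element i)
    element-index     : ∀ z z<N z∈Cl → element (index z z<N z∈Cl) ≡ z
    element-injective : ∀ {i j} → element i ≡ element j → i ≡ j

module OrderUpToSign
  (N : ℕ) .{{_ : ℕ.NonZero N}} (Cl : ℤ → Set)
  (Cl-resp : ∀ {x y} → Congruence._≈_ N x y → Cl x → Cl y)
  (Cl-neg : ∀ {x} → Cl x → Cl (- x))
  (Cl-¬self-negative : ∀ {x} → Cl x → ¬ Congruence._≈_ N x (- x))
  (m : ℕ) (enumeration : Enumeration N Cl (m ℕ.+ m))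
  (c θ θ⁻¹ : ℤ) (θθ⁻¹≈1 : Congruence._≈_ N (θ * θ⁻¹) 1ℤ)
  (orbit-∈ : ∀ k → Cl (c * θ ^ k))
  (orbit-complete : ∀ z → z ℕ.< N → Cl (+ z) → ∃ λ k → Congruence._≈±_ N (+ z) (c * θ ^ k))
  where

  open Congruence N
  open Residues N
  open Orbit N c θ θ⁻¹ θθ⁻¹≈1
  open Enumeration enumeration

  signed : ∀ {k} → Fin k ⊎ Fin k → ℤ
  signed (inj₁ a) = orbit (toℕ a)
  signed (inj₂ a) = - orbit (toℕ a)

  signed-∈ : ∀ {k} (u : Fin k ⊎ Fin k) → Cl (signed u)
  signed-∈ (inj₁ a) = orbit-∈ (toℕ a)
  signed-∈ (inj₂ a) = Cl-neg (orbit-∈ (toℕ a))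

  Period : ℕ → Set
  Period t = 0 ℕ.< t × orbit t ≈± c

  ascending-collision : ∀ {a b} → a ℕ.< b → orbit a ≈± orbit b → Period (b ∸ a)
  ascending-collision {a} {b} a<b oa≈±ob =
    ℕ.m<n⇒0<n∸m a<b ,
    ≈±-sym (orbit-cancel a (b ∸ a)
      (subst (λ e → orbit a ≈± orbit e) (sym (ℕ.m+[n∸m]≡n (ℕ.<⇒≤ a<b))) oa≈±ob))

  exponent-collision : ∀ {k a b} → a ℕ.< k → b ℕ.< k → a ≢ b → orbit a ≈± orbit b →
                       ∃ λ t → t ℕ.< k × Period t
  exponent-collision {k} {a} {b} a<k b<k a≢b oa≈±ob with ℕ.<-cmp a b
  ... | tri< a<b _ _ = b ∸ a , ℕ.≤-<-trans (ℕ.m∸n≤m b a) b<k , ascending-collision a<b oa≈±ob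
  ... | tri≈ _ a≡b _ = ⊥-elim (a≢b a≡b)
  ... | tri> _ _ b<a = a ∸ b , ℕ.≤-<-trans (ℕ.m∸n≤m a b) a<k , ascending-collision b<a (≈±-sym oa≈±ob)

  opposite-collision : ∀ {k} (a b : Fin k) → orbit (toℕ a) ≈ - orbit (toℕ b) → ∃ λ t → t ℕ.< k × Period t
  opposite-collision a b oa≈-ob with toℕ a ℕ.≟ toℕ b
  ... | yes a≡b = ⊥-elim (Cl-¬self-negative (orbit-∈ (toℕ a))
                           (subst (λ e → orbit (toℕ a) ≈ - orbit e) (sym a≡b) oa≈-ob))
  ... | no a≢b  = exponent-collision (toℕ<n a) (toℕ<n b) a≢b (inj₂ oa≈-ob)

  signed-collision : ∀ {k} {u v : Fin k ⊎ Fin k} → u ≢ v → signed u ≈ signed v → ∃ λ t → t ℕ.< k × Period t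
  signed-collision {u = inj₁ a} {inj₁ b} u≢v su≈sv =
    exponent-collision (toℕ<n a) (toℕ<n b) (u≢v ∘ cong inj₁ ∘ toℕ-injective) (inj₁ su≈sv)
  signed-collision {u = inj₂ a} {inj₂ b} u≢v su≈sv =
    exponent-collision (toℕ<n a) (toℕ<n b) (u≢v ∘ cong inj₂ ∘ toℕ-injective) (inj₁ (-‿injective su≈sv))
  signed-collision {u = inj₁ a} {inj₂ b} _ su≈sv = opposite-collision a b su≈sv
  signed-collision {u = inj₂ a} {inj₁ b} _ su≈sv = opposite-collision a b (≈-neg-swap (≈-sym su≈sv))

  signed-of : ∀ {t x r} (r<t : r ℕ.< t) → x ≈± orbit r → Σ (Fin t ⊎ Fin t) λ u → x ≈ signed u
  signed-of {x = x} r<t (inj₁ x≈or)  =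
    inj₁ (fromℕ< r<t) , subst (λ e → x ≈ orbit e) (sym (toℕ-fromℕ< r<t)) x≈or
  signed-of {x = x} r<t (inj₂ x≈-or) =
    inj₂ (fromℕ< r<t) , subst (λ e → x ≈ - orbit e) (sym (toℕ-fromℕ< r<t)) x≈-or

  signed-representative : ∀ {t} → Period t → ∀ z → z ℕ.< N → Cl (+ z) →
                          Σ (Fin t ⊎ Fin t) λ u → + z ≈ signed u
  signed-representative {suc t′} (_ , period) z z<N z∈Cl =
    let k , z≈±ok = orbit-complete z z<N z∈Cl
    in signed-of (m%n<n k (suc t′)) (≈±-trans z≈±ok (orbit-mod-period period k))

  orbit-complete-ℤ : ∀ {x} → Cl x → ∃ λ k → x ≈± orbit k
  orbit-complete-ℤ {x} x∈Cl =
    let k , rx≈±ok = orbit-complete (residue x) (residue-< x) (Cl-resp (≈-sym (residue-≈ x)) x∈Cl)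
    in k , ≈±-cong (residue-≈ x) ≈-refl rx≈±ok

  -- A period t < m would represent the 2m elements of Cl by only 2t signed orbit elements.
  aperiodic : ∀ {t} → t ℕ.< m → ¬ Period t
  aperiodic {t} t<m per = no-collision (pigeonhole (ℕ.+-mono-< t<m t<m) code)
    where
    representative : (i : Fin (m ℕ.+ m)) → Σ (Fin t ⊎ Fin t) λ u → + element i ≈ signed u
    representative i = signed-representative per (element i) (element-< i) (element-∈ i)
    code : Fin (m ℕ.+ m) → Fin (t ℕ.+ t)
    code i = join t t (proj₁ (representative i))
    no-collision : ¬ ∃₂ λ i j → i Fin.< j × code i ≡ code j
    no-collision (i , j , i<j , code≡) =
      Fin.<⇒≢ i<j (element-injective (≈-<-injective (element-< i) (element-< j) (begin
        + element i                        ≈⟨ proj₂ (representative i) ⟩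
        signed (proj₁ (representative i))  ≡⟨ cong signed same-representative ⟩
        signed (proj₁ (representative j))  ≈⟨ ≈-sym (proj₂ (representative j)) ⟩
        + element j                        ∎)))
      where
      open ≈-Reasoning
      same-representative : proj₁ (representative i) ≡ proj₁ (representative j)
      same-representative = trans (sym (splitAt-join t t _)) (trans (cong (splitAt t) code≡) (splitAt-join t t _))

  -- The 2(m + 1) signed orbit elements ±cθᵏ with k ≤ m all lie in Cl, which has only 2m elements.
  period : orbit m ≈± c
  period = from-collision (pigeonhole (ℕ.+-mono-< (ℕ.n<1+n m) (ℕ.n<1+n m)) code)
    where
    value : Fin (suc m ℕ.+ suc m) → ℤ
    value i = signed (splitAt (suc m) i)
    code : Fin (suc m ℕ.+ suc m) → Fin (m ℕ.+ m)
    code i = index (residue (value i)) (residue-< (value i))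
                   (Cl-resp (≈-sym (residue-≈ (value i))) (signed-∈ (splitAt (suc m) i)))
    exact-period : ∀ {t} → t ℕ.< suc m → Period t → orbit m ≈± c
    exact-period t<1+m per with ℕ.m≤n⇒m<n∨m≡n (ℕ.s≤s⁻¹ t<1+m)
    ... | inj₁ t<m  = ⊥-elim (aperiodic t<m per)
    ... | inj₂ refl = proj₂ per
    from-collision : ∃₂ (λ i j → i Fin.< j × code i ≡ code j) → orbit m ≈± c
    from-collision (i , j , i<j , code≡) =
      let t , t<1+m , per = signed-collision {u = splitAt (suc m) i} split-≢ (residue-≡⇒≈ same-residue)
      in exact-period t<1+m per
      where
      same-residue : residue (value i) ≡ residue (value j)
      same-residue = trans (sym (element-index _ _ _)) (trans (cong element code≡) (element-index _ _ _))
      split-≢ : splitAt (suc m) i ≢ splitAt (suc m) j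
      split-≢ split≡ = Fin.<⇒≢ i<j (trans (sym (join-splitAt (suc m) (suc m) i))
        (trans (cong (join (suc m) (suc m)) split≡) (join-splitAt (suc m) (suc m) j)))

module PairSystems (N : ℕ) .{{_ : ℕ.NonZero N}} where

  open Congruence N
  open Residues N
  open ZMod N using (_∈ₘ_; ±⟨_,_⟩; _-ₘ_; _+ₘ_; card; PPS)

  infix 4 _∈±⟨_,_⟩

  _∈±⟨_,_⟩ : ℤ → ℤ → ℤ → Set
  z ∈±⟨ x , y ⟩ = z ≈± x ⊎ z ≈± y

  Excluded : ℤ → ℤ → ℤ → Set
  Excluded x y z = z ≈ 0ℤ ⊎ z ∈±⟨ x , y ⟩

  -- For a list S of pairs {x, y}, the paper's unions ⋃ ±{x, y} and ⋃ ±{x − y, x + y}, read up to congruence.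
  ±-Covered : List (ℕ × ℕ) → ℤ → Set
  ±-Covered S z = Any (λ ab → z ∈±⟨ + proj₁ ab , + proj₂ ab ⟩) S

  ∓-Covered : List (ℕ × ℕ) → ℤ → Set
  ∓-Covered S z = Any (λ ab → z ∈±⟨ + (proj₁ ab -ₘ proj₂ ab) , + (proj₁ ab +ₘ proj₂ ab) ⟩) S

  _IsComplementOf_ : (ℤ → Set) → (ℤ → Set) → Set
  C IsComplementOf A = ∀ z → (¬ A z → C z) × (C z → ¬ A z)

  ∈±-resp : ∀ {x x′ y y′ z} → x ≈± x′ → y ≈± y′ → z ∈±⟨ x , y ⟩ → z ∈±⟨ x′ , y′ ⟩
  ∈±-resp x≈±x′ y≈±y′ = Sum.map (λ z≈±x → ≈±-trans z≈±x x≈±x′) (λ z≈±y → ≈±-trans z≈±y y≈±y′)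

  ∈ₘ±⟨⟩⇒ : ∀ {x y z} → z ∈ₘ ±⟨ x , y ⟩ → + z ∈±⟨ + x , + y ⟩
  ∈ₘ±⟨⟩⇒ (here x≡z)                 = inj₁ (inj₁ (≈-sym (≡ₘ⇒≈ x≡z)))
  ∈ₘ±⟨⟩⇒ {x} (there (here -x≡z))    = inj₁ (inj₂ (≈-trans (≈-sym (≡ₘ⇒≈ -x≡z)) (negₘ-≈ x)))
  ∈ₘ±⟨⟩⇒ (there (there (here y≡z))) = inj₂ (inj₁ (≈-sym (≡ₘ⇒≈ y≡z)))
  ∈ₘ±⟨⟩⇒ {y = y} (there (there (there (here -y≡z)))) =
    inj₂ (inj₂ (≈-trans (≈-sym (≡ₘ⇒≈ -y≡z)) (negₘ-≈ y)))

  ∈ₘ±⟨⟩⇐ : ∀ {x y z} → + z ∈±⟨ + x , + y ⟩ → z ∈ₘ ±⟨ x , y ⟩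
  ∈ₘ±⟨⟩⇐ (inj₁ (inj₁ z≈x))      = here (≈⇒≡ₘ (≈-sym z≈x))
  ∈ₘ±⟨⟩⇐ {x} (inj₁ (inj₂ z≈-x)) = there (here (≈⇒≡ₘ (≈-trans (negₘ-≈ x) (≈-sym z≈-x))))
  ∈ₘ±⟨⟩⇐ (inj₂ (inj₁ z≈y))      = there (there (here (≈⇒≡ₘ (≈-sym z≈y))))
  ∈ₘ±⟨⟩⇐ {y = y} (inj₂ (inj₂ z≈-y)) =
    there (there (there (here (≈⇒≡ₘ (≈-trans (negₘ-≈ y) (≈-sym z≈-y))))))

  ∈ₘ-excluded⇒ : ∀ {x y z} → z ∈ₘ (0 ∷ ±⟨ x , y ⟩) → Excluded (+ x) (+ y) (+ z)
  ∈ₘ-excluded⇒ (here 0≡z)  = inj₁ (≈-sym (≡ₘ⇒≈ 0≡z))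
  ∈ₘ-excluded⇒ (there z∈±) = inj₂ (∈ₘ±⟨⟩⇒ z∈±)

  ∈ₘ-excluded⇐ : ∀ {x y z} → Excluded (+ x) (+ y) (+ z) → z ∈ₘ (0 ∷ ±⟨ x , y ⟩)
  ∈ₘ-excluded⇐ (inj₁ z≈0)  = here (≈⇒≡ₘ (≈-sym z≈0))
  ∈ₘ-excluded⇐ (inj₂ z∈±) = there (∈ₘ±⟨⟩⇐ z∈±)

  PPS-intro : ∀ {x y x′ y′} (S : List (ℕ × ℕ)) →
    card (0 ∷ ±⟨ x , y ⟩) ≡ card (0 ∷ ±⟨ x′ , y′ ⟩) →
    4 ℕ.* length S ℕ.+ card (0 ∷ ±⟨ x , y ⟩) ≡ N →
    All (λ ab → proj₁ ab ℕ.< N × proj₂ ab ℕ.< N) S →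
    ±-Covered S IsComplementOf Excluded (+ x) (+ y) →
    ∓-Covered S IsComplementOf Excluded (+ x′) (+ y′) →
    PPS (0 ∷ ±⟨ x , y ⟩) (0 ∷ ±⟨ x′ , y′ ⟩)
  PPS-intro S card≡ size bounded ±-complement ∓-complement =
    card≡ , S , size , bounded ,
    (λ z _ → Any.map ∈ₘ±⟨⟩⇐ ∘ proj₁ (±-complement (+ z)) ∘ (_∘ ∈ₘ-excluded⇐) ,
             (_∘ ∈ₘ-excluded⇒) ∘ proj₂ (±-complement (+ z)) ∘ Any.map ∈ₘ±⟨⟩⇒) ,
    (λ z _ → Any.map ∈ₘ±⟨⟩⇐ ∘ proj₁ (∓-complement (+ z)) ∘ (_∘ ∈ₘ-excluded⇐) ,
             (_∘ ∈ₘ-excluded⇒) ∘ proj₂ (∓-complement (+ z)) ∘ Any.map ∈ₘ±⟨⟩⇒)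

  Any-zipWith : ∀ {P Q R : ℕ × ℕ → Set} {S} → (∀ {ab} → P ab → Q ab → R ab) → All P S → Any Q S → Any R S
  Any-zipWith f (p ∷ _)  (here q)  = here (f p q)
  Any-zipWith f (_ ∷ ps) (there q) = there (Any-zipWith f ps q)

  DiffSumScaled : ℤ → ℕ × ℕ → Set
  DiffSumScaled u (a , b) = + (a -ₘ b) ≈± u * + a × + (a +ₘ b) ≈± u * + b

  module Scaling (u u⁻¹ : ℤ) (uu⁻¹≈1 : u * u⁻¹ ≈ 1ℤ) where

    u⁻¹u≈1 : u⁻¹ * u ≈ 1ℤ
    u⁻¹u≈1 = ≈-trans (≈-reflexive (ℤ.*-comm u⁻¹ u)) uu⁻¹≈1

    ≈±-unscale : ∀ {z x} → z ≈± u * x → u⁻¹ * z ≈± x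
    ≈±-unscale {x = x} = ≈±-cong ≈-refl (inverse-cancel u u⁻¹ x uu⁻¹≈1) ∘ *-congˡ-≈± u⁻¹

    ≈±-rescale : ∀ {z x} → u⁻¹ * z ≈± x → z ≈± u * x
    ≈±-rescale {z} = ≈±-cong (inverse-cancel u⁻¹ u z u⁻¹u≈1) ≈-refl ∘ *-congˡ-≈± u

    ∈±-unscale : ∀ {z x y} → z ∈±⟨ u * x , u * y ⟩ → u⁻¹ * z ∈±⟨ x , y ⟩
    ∈±-unscale = Sum.map ≈±-unscale ≈±-unscale

    ∈±-rescale : ∀ {z x y} → u⁻¹ * z ∈±⟨ x , y ⟩ → z ∈±⟨ u * x , u * y ⟩
    ∈±-rescale = Sum.map ≈±-rescale ≈±-rescale

    module _ {S} (scaled : All (DiffSumScaled u) S) where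

      ∓-Covered⇒ : ∀ {z} → ∓-Covered S z → ±-Covered S (u⁻¹ * z)
      ∓-Covered⇒ = Any-zipWith (λ (d≈±ua , s≈±ub) → ∈±-unscale ∘ ∈±-resp d≈±ua s≈±ub) scaled

      ∓-Covered⇐ : ∀ {z} → ±-Covered S (u⁻¹ * z) → ∓-Covered S z
      ∓-Covered⇐ = Any-zipWith
        (λ (d≈±ua , s≈±ub) → ∈±-resp (≈±-sym d≈±ua) (≈±-sym s≈±ub) ∘ ∈±-rescale) scaled

    module _ {x y x′ y′} (x′≈±ux : x′ ≈± u * x) (y′≈±uy : y′ ≈± u * y) where

      excluded-unscale : ∀ {z} → Excluded x′ y′ z → Excluded x y (u⁻¹ * z)
      excluded-unscale (inj₁ z≈0) = inj₁ (≈-trans (*-cong (≈-refl {u⁻¹}) z≈0) (≈-reflexive (ℤ.*-zeroʳ u⁻¹)))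
      excluded-unscale (inj₂ z∈±) = inj₂ (∈±-unscale (∈±-resp x′≈±ux y′≈±uy z∈±))

      excluded-rescale : ∀ {z} → Excluded x y (u⁻¹ * z) → Excluded x′ y′ z
      excluded-rescale {z} (inj₁ u⁻¹z≈0) = inj₁ (begin
        z              ≈⟨ ≈-sym (inverse-cancel u⁻¹ u z u⁻¹u≈1) ⟩
        u * (u⁻¹ * z)  ≈⟨ *-cong (≈-refl {u}) u⁻¹z≈0 ⟩
        u * 0ℤ         ≡⟨ ℤ.*-zeroʳ u ⟩
        0ℤ             ∎)
        where open ≈-Reasoning
      excluded-rescale (inj₂ u⁻¹z∈±) =
        inj₂ (∈±-resp (≈±-sym x′≈±ux) (≈±-sym y′≈±uy) (∈±-rescale u⁻¹z∈±))

    scale-complement : ∀ {S x y x′ y′} → All (DiffSumScaled u) S → x′ ≈± u * x → y′ ≈± u * y →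
                       ±-Covered S IsComplementOf Excluded x y → ∓-Covered S IsComplementOf Excluded x′ y′
    scale-complement scaled x′≈±ux y′≈±uy complement z =
      (λ z∉A′ → ∓-Covered⇐ scaled
        (proj₁ (complement (u⁻¹ * z)) (z∉A′ ∘ excluded-rescale x′≈±ux y′≈±uy))) ,
      (λ z∈S z∈A′ → proj₂ (complement (u⁻¹ * z))
        (∓-Covered⇒ scaled z∈S) (excluded-unscale x′≈±ux y′≈±uy z∈A′))

parity : ∀ r → ∃ λ i → r ≡ i ℕ.+ i ⊎ r ≡ suc (i ℕ.+ i)
parity zero          = 0 , inj₁ refl
parity (suc zero)    = 0 , inj₂ refl
parity (suc (suc r)) with parity r
... | i , inj₁ refl = suc i , inj₁ (cong suc (sym (ℕ.+-suc i i)))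
... | i , inj₂ refl = suc i , inj₂ (cong (suc ∘ suc) (sym (ℕ.+-suc i i)))

half-< : ∀ {i r L} → r ≡ i ℕ.+ i ⊎ r ≡ suc (i ℕ.+ i) → r ℕ.< L ℕ.+ L → i ℕ.< L
half-< {i} r≡ r<2L = ℕ.≰⇒> (λ L≤i → ℕ.<⇒≱ r<2L (ℕ.≤-trans (ℕ.+-mono-≤ L≤i L≤i) (2i≤r r≡)))
  where
  2i≤r : ∀ {r} → r ≡ i ℕ.+ i ⊎ r ≡ suc (i ℕ.+ i) → i ℕ.+ i ℕ.≤ r
  2i≤r (inj₁ refl) = ℕ.≤-refl
  2i≤r (inj₂ refl) = ℕ.n≤1+n _

module OrbitPairs
  (N : ℕ) .{{_ : ℕ.NonZero N}} (c θ θ⁻¹ : ℤ) (θθ⁻¹≈1 : Congruence._≈_ N (θ * θ⁻¹) 1ℤ)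
  (L : ℕ) (period : Congruence._≈±_ N (c * θ ^ suc (L ℕ.+ L)) c)
  where

  open Congruence N
  open Residues N
  open Orbit N c θ θ⁻¹ θθ⁻¹≈1
  open PairSystems N

  pair : ℕ → ℕ × ℕ
  pair i = residue (orbit (suc (i ℕ.+ i))) , residue (orbit (suc (suc (i ℕ.+ i))))

  pairs : List (ℕ × ℕ)
  pairs = map pair (upTo L)

  length-pairs : length pairs ≡ L
  length-pairs = trans (List.length-map pair (upTo L)) (List.length-upTo L)

  pairs-bounded : All (λ ab → proj₁ ab ℕ.< N × proj₂ ab ℕ.< N) pairs
  pairs-bounded = All.map⁺ (All.universal
    (λ i → residue-< (orbit (suc (i ℕ.+ i))) , residue-< (orbit (suc (suc (i ℕ.+ i))))) (upTo L))

  exponent-covered : ∀ {z} r → r ℕ.< suc (L ℕ.+ L) → z ≈± orbit r → z ≈± c ⊎ ±-Covered pairs z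
  exponent-covered zero _ z≈±o0 = inj₁ (≈±-cong ≈-refl (≈-reflexive (ℤ.*-identityʳ c)) z≈±o0)
  exponent-covered {z} (suc r) r<2L+1 z≈±or with parity r
  ... | i , r≡ = inj₂ (Any.map⁺ (lose (∈-upTo⁺ (half-< {i} r≡ (ℕ.s≤s⁻¹ r<2L+1))) (in-pair r≡)))
    where
    in-pair : r ≡ i ℕ.+ i ⊎ r ≡ suc (i ℕ.+ i) → z ∈±⟨ + proj₁ (pair i) , + proj₂ (pair i) ⟩
    in-pair (inj₁ refl) = inj₁ (≈±-cong ≈-refl (≈-sym (residue-≈ _)) z≈±or)
    in-pair (inj₂ refl) = inj₂ (≈±-cong ≈-refl (≈-sym (residue-≈ _)) z≈±or)

  orbit-covered : ∀ {z} k → z ≈± orbit k → z ≈± c ⊎ ±-Covered pairs z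
  orbit-covered k z≈±ok =
    exponent-covered (k % suc (L ℕ.+ L)) (m%n<n k _) (≈±-trans z≈±ok (orbit-mod-period period k))

  covered-exponent : ∀ {z} → ±-Covered pairs z → ∃ λ k → 0 ℕ.< k × k ℕ.< suc (L ℕ.+ L) × z ≈± orbit k
  covered-exponent z∈pairs with find (Any.map⁻ z∈pairs)
  ... | i , i∈upTo , inj₁ z≈±x =
    suc (i ℕ.+ i) , ℕ.z<s , ℕ.s≤s (ℕ.+-mono-< i<L i<L) , ≈±-cong ≈-refl (residue-≈ _) z≈±x
    where i<L = ∈-upTo⁻ i∈upTo
  ... | i , i∈upTo , inj₂ z≈±y =
    suc (suc (i ℕ.+ i)) , ℕ.z<s , ℕ.s≤s (subst (ℕ._≤ L ℕ.+ L) (cong suc (ℕ.+-suc i i)) (ℕ.+-mono-≤ i<L i<L)) ,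
    ≈±-cong ≈-refl (residue-≈ _) z≈±y
    where i<L = ∈-upTo⁻ i∈upTo

module SilverRatio (N : ℕ) .{{_ : ℕ.NonZero N}} (s : ℤ) (s²≈2 : Congruence._≈_ N (s * s) (+ 2)) where

  open Congruence N
  open Residues N
  open PairSystems N
  open ZMod N using (_-ₘ_; _+ₘ_)

  θ θ⁻¹ : ℤ
  θ   = 1ℤ + s
  θ⁻¹ = s - 1ℤ

  θθ⁻¹≈1 : θ * θ⁻¹ ≈ 1ℤ
  θθ⁻¹≈1 = begin
    (1ℤ + s) * (s - 1ℤ)  ≡⟨ expand s ⟩
    s * s - 1ℤ           ≈⟨ +-cong s²≈2 ≈-refl ⟩
    1ℤ                   ∎
    where
    open ≈-Reasoning
    expand : ∀ s → (1ℤ + s) * (s - 1ℤ) ≡ s * s - 1ℤ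
    expand = solve-∀

  consecutive-DiffSumScaled : ∀ c k → DiffSumScaled s (residue (c * θ ^ k) , residue (c * θ ^ suc k))
  consecutive-DiffSumScaled c k = inj₂ difference , inj₁ sum
    where
    x = c * θ ^ k
    y = c * θ ^ suc k
    a = residue x
    b = residue y
    difference : + (a -ₘ b) ≈ - (s * + a)
    difference = begin
      + (a -ₘ b)     ≈⟨ -ₘ-≈ a b ⟩
      + a - + b      ≈⟨ +-cong (residue-≈ x) (-‿cong (residue-≈ y)) ⟩
      x - y          ≡⟨ identity c (θ ^ k) s ⟩
      - (s * x)      ≈⟨ -‿cong (*-cong (≈-refl {s}) (≈-sym (residue-≈ x))) ⟩
      - (s * + a)    ∎
      where
      open ≈-Reasoning
      identity : ∀ c T s → c * T - c * ((1ℤ + s) * T) ≡ - (s * (c * T))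
      identity = solve-∀
    sum : + (a +ₘ b) ≈ s * + b
    sum = begin
      + (a +ₘ b)                   ≈⟨ +ₘ-≈ a b ⟩
      + a + + b                    ≈⟨ +-cong (residue-≈ x) (residue-≈ y) ⟩
      x + y                        ≡⟨ identity c (θ ^ k) s ⟩
      s * y + (+ 2 - s * s) * x    ≈⟨ +-cong (≈-refl {s * y})
                                        (*-cong (+-cong (≈-refl {+ 2}) (-‿cong s²≈2)) (≈-refl {x})) ⟩
      s * y + (+ 2 - + 2) * x      ≡⟨ ℤ.+-identityʳ (s * y) ⟩
      s * y                        ≈⟨ *-cong (≈-refl {s}) (≈-sym (residue-≈ y)) ⟩
      s * + b                      ∎
      where
      open ≈-Reasoning
      identity : ∀ c T s → c * T + c * ((1ℤ + s) * T) ≡ s * (c * ((1ℤ + s) * T)) + (+ 2 - s * s) * (c * T)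
      identity = solve-∀

module _ {A : Set} where

  length-filter-∪ : ∀ {Q R : A → Set} (Q? : U.Decidable Q) (R? : U.Decidable R) → (∀ {x} → Q x → ¬ R x) →
                    ∀ xs → length (filter (λ x → Q? x ⊎-dec R? x) xs) ≡
                           length (filter Q? xs) ℕ.+ length (filter R? xs)
  length-filter-∪ Q? R? disjoint [] = refl
  length-filter-∪ Q? R? disjoint (x ∷ xs) with Q? x | R? x
  ... | yes q | yes r = ⊥-elim (disjoint q r)
  ... | yes _ | no _  = cong suc (length-filter-∪ Q? R? disjoint xs)
  ... | no _  | yes _ = trans (cong suc (length-filter-∪ Q? R? disjoint xs)) (sym (ℕ.+-suc _ _))
  ... | no _  | no _  = length-filter-∪ Q? R? disjoint xs

  length-filter-unique : ∀ {P : A → Set} (P? : U.Decidable P) {r xs} → Unique xs → r ∈ xs →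
                         All (λ x → P x → x ≡ r) xs → P r → length (filter P? xs) ≡ 1
  length-filter-unique P? (r∉xs ∷ _) (here refl) (_ ∷ only-r) Pr =
    trans (cong length (List.filter-accept P? Pr))
          (cong (suc ∘ length) (List.filter-none P?
            (All.zipWith (λ (r≢x , Px⇒x≡r) Px → r≢x (sym (Px⇒x≡r Px))) (r∉xs , only-r))))
  length-filter-unique P? (x∉xs ∷ unique) (there r∈xs) (Px⇒x≡r ∷ only-r) Pr =
    trans (cong length (List.filter-reject P? (λ Px → All.lookup x∉xs r∈xs (Px⇒x≡r Px))))
          (length-filter-unique P? unique r∈xs only-r Pr)

module Cardinality (N : ℕ) .{{_ : ℕ.NonZero N}} where

  open Congruence N
  open Residues N
  open ZMod N using (card; ±⟨_,_⟩)

  Incongruent : ℕ → ℕ → Set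
  Incongruent a b = ¬ + a ≈ + b

  card-[] : card [] ≡ 0
  card-[] = cong length (List.filter-none _ (All.universal (λ _ ()) (upTo N)))

  card-∷ : ∀ {a A} → All (Incongruent a) A → card (a ∷ A) ≡ suc (card A)
  card-∷ {a} {A} a∉A = begin
    card (a ∷ A)                                            ≡⟨ cong length (List.filter-≐ _ (λ z → same? z ⊎-dec in-A? z)
                                                                 (Any.toSum , Any.fromSum) (upTo N)) ⟩
    length (filter (λ z → same? z ⊎-dec in-A? z) (upTo N))  ≡⟨ length-filter-∪ same? in-A? disjoint (upTo N) ⟩
    length (filter same? (upTo N)) ℕ.+ card A               ≡⟨ cong (ℕ._+ card A) single ⟩
    suc (card A)                                            ∎
    where
    open ≡-Reasoning
    same? = λ z → a mod N ℕ.≟ z mod N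
    in-A? = λ z → Any.any? (λ b → b mod N ℕ.≟ z mod N) A
    disjoint : ∀ {z} → a mod N ≡ z mod N → ¬ Any (λ b → b mod N ≡ z mod N) A
    disjoint a≡z b≡z with All.lookupAny a∉A b≡z
    ... | a≉b , b≡z′ = a≉b (≡ₘ⇒≈ (trans a≡z (sym b≡z′)))
    mod-< : ∀ z → z mod N ℕ.< N
    mod-< z = subst (ℕ._< N) (sym (mod≡% z N)) (m%n<n z N)
    mod-small : ∀ {z} → z ℕ.< N → z mod N ≡ z
    mod-small {z} z<N = trans (mod≡% z N) (m<n⇒m%n≡m z<N)
    single : length (filter same? (upTo N)) ≡ 1
    single = length-filter-unique same? (Unique.upTo⁺ N) (∈-upTo⁺ (mod-< a))
      (All.tabulate (λ z∈ a≡z → sym (trans a≡z (mod-small (∈-upTo⁻ z∈)))))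
      (sym (mod-small (mod-< a)))

  card-distinct : ∀ {A} → AllPairs Incongruent A → card A ≡ length A
  card-distinct []                 = card-[]
  card-distinct (a∉A ∷ A-distinct) = trans (card-∷ a∉A) (cong suc (card-distinct A-distinct))

  card-excluded : ∀ {x y} → ¬ + x ≈ 0ℤ → ¬ + y ≈ 0ℤ → ¬ + x ≈ - + x → ¬ + y ≈ - + y →
                  ¬ + x ≈± + y → card (0 ∷ ±⟨ x , y ⟩) ≡ 5
  card-excluded {x} {y} x≉0 y≉0 x≉-x y≉-y x≉±y = card-distinct
      ((apart ≈-refl ≈-refl (x≉0 ∘ ≈-sym) ∷ apart ≈-refl -x≈ (0≉- x≉0) ∷
        apart ≈-refl ≈-refl (y≉0 ∘ ≈-sym) ∷ apart ≈-refl -y≈ (0≉- y≉0) ∷ [])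
     ∷ (apart ≈-refl -x≈ x≉-x ∷ apart ≈-refl ≈-refl (x≉±y ∘ inj₁) ∷
        apart ≈-refl -y≈ (x≉±y ∘ inj₂) ∷ [])
     ∷ (apart -x≈ ≈-refl (x≉±y ∘ inj₂ ∘ ≈-neg-swap ∘ ≈-sym) ∷
        apart -x≈ -y≈ (x≉±y ∘ inj₁ ∘ -‿injective) ∷ [])
     ∷ (apart ≈-refl -y≈ y≉-y ∷ [])
     ∷ [] ∷ [])
    where
    apart : ∀ {a b a′ b′} → + a ≈ a′ → + b ≈ b′ → ¬ a′ ≈ b′ → Incongruent a b
    apart a≈a′ b≈b′ a′≉b′ a≈b = a′≉b′ (≈-trans (≈-sym a≈a′) (≈-trans a≈b b≈b′))
    -x≈ = negₘ-≈ x
    -y≈ = negₘ-≈ y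
    0≉- : ∀ {x} → ¬ x ≈ 0ℤ → ¬ 0ℤ ≈ - x
    0≉- x≉0 0≈-x = x≉0 (-‿injective {y = 0ℤ} (≈-sym 0≈-x))

digits-< : ∀ {a b x y} → a ℕ.< x → b ℕ.< y → a ℕ.* y ℕ.+ b ℕ.< x ℕ.* y
digits-< {a} {b} {x} {y} a<x b<y = begin-strict
  a ℕ.* y ℕ.+ b   <⟨ ℕ.+-monoʳ-< (a ℕ.* y) b<y ⟩
  a ℕ.* y ℕ.+ y   ≡⟨ ℕ.+-comm (a ℕ.* y) y ⟩
  suc a ℕ.* y     ≤⟨ ℕ.*-monoˡ-≤ y a<x ⟩
  x ℕ.* y         ∎
  where open ℕ.≤-Reasoning

[a*d+b]/d≡a : ∀ a {b} d .{{_ : ℕ.NonZero d}} → b ℕ.< d → (a ℕ.* d ℕ.+ b) ℕ./ d ≡ a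
[a*d+b]/d≡a a {b} d b<d = begin
  (a ℕ.* d ℕ.+ b) ℕ./ d         ≡⟨ +-distrib-/-∣ˡ b (ℕ.n∣m*n a) ⟩
  a ℕ.* d ℕ./ d ℕ.+ b ℕ./ d     ≡⟨ cong₂ ℕ._+_ (m*n/n≡m a d) (m<n⇒m/n≡0 b<d) ⟩
  a ℕ.+ 0                       ≡⟨ ℕ.+-identityʳ a ⟩
  a                             ∎
  where open ≡-Reasoning

[a*d+b]%d≡b : ∀ a {b} d .{{_ : ℕ.NonZero d}} → b ℕ.< d → (a ℕ.* d ℕ.+ b) % d ≡ b
[a*d+b]%d≡b a d b<d = trans (%-remove-+ˡ _ (ℕ.n∣m*n a)) (m<n⇒m%n≡m b<d)

module PrimeSquare (q : ℕ) (p-prime : Prime (suc (suc q))) where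

  p p-1 N : ℕ
  p   = suc (suc q)
  p-1 = suc q
  N   = p ℕ.* p

  open Congruence N
  open Residues N

  p∣-resp : ∀ {x y} → x ≈ y → + p ∣ x → + p ∣ y
  p∣-resp {x} {y} (congruent N∣x-y) p∣x =
    subst (+ p ∣_) (x-[x-y]≡y x y) (∣m∣n⇒∣m-n p∣x (∣-trans p∣N N∣x-y))
    where
    p∣N : + p ∣ + N
    p∣N = divides (+ p) (ℤ.pos-* p p)
    x-[x-y]≡y : ∀ x y → x - (x - y) ≡ y
    x-[x-y]≡y = solve-∀

  p∣-resp± : ∀ {x y} → x ≈± y → + p ∣ x → + p ∣ y
  p∣-resp± (inj₁ x≈y) p∣x = p∣-resp x≈y p∣x
  p∣-resp± {y = y} (inj₂ x≈-y) p∣x = subst (+ p ∣_) (ℤ.neg-involutive y) (∣m⇒∣-m (p∣-resp x≈-y p∣x))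

  euclid : ∀ {x y} → + p ∣ x * y → + p ∣ x ⊎ + p ∣ y
  euclid {x} {y} p∣xy = Sum.map ∣ᵤ⇒∣ ∣ᵤ⇒∣
    (euclidsLemma ℤ.∣ x ∣ ℤ.∣ y ∣ p-prime (subst (p ℕ.∣_) (ℤ.abs-* x y) (∣⇒∣ᵤ p∣xy)))

  p∤1 : ¬ + p ∣ 1ℤ
  p∤1 p∣1 = ℕ.nonTrivial⇒≢1 {{prime⇒nonTrivial p-prime}} (ℕ.∣1⇒≡1 (∣⇒∣ᵤ p∣1))

  p∣⇒p*≈0 : ∀ {x} → + p ∣ x → + p * x ≈ 0ℤ
  p∣⇒p*≈0 (divides k refl) = congruent (divides k (trans (regroup (+ p) k) (cong (k *_) (sym (ℤ.pos-* p p)))))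
    where
    regroup : ∀ p k → p * (k * p) - 0ℤ ≡ k * (p * p)
    regroup = solve-∀

  p*≈0⇒p∣ : ∀ {x} → + p * x ≈ 0ℤ → + p ∣ x
  p*≈0⇒p∣ {x} (congruent N∣px-0) = ∣ᵤ⇒∣ (Unsigned.*-cancelˡ-∣ (+ p) {+ p} {x}
    (subst₂ Unsigned._∣_ (ℤ.pos-* p p) (ℤ.+-identityʳ (+ p * x)) (∣⇒∣ᵤ N∣px-0)))

  Unit : ℤ → Set
  Unit x = ¬ + p ∣ x

  Unit-resp : ∀ {x y} → x ≈ y → Unit x → Unit y
  Unit-resp x≈y x-unit = x-unit ∘ p∣-resp (≈-sym x≈y)

  Unit-resp± : ∀ {x y} → x ≈± y → Unit x → Unit y
  Unit-resp± x≈±y x-unit = x-unit ∘ p∣-resp± (≈±-sym x≈±y)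

  Unit-neg : ∀ {x} → Unit x → Unit (- x)
  Unit-neg {x} = Unit-resp± (inj₂ (≈-reflexive (sym (ℤ.neg-involutive x))))

  Unit-* : ∀ {x y} → Unit x → Unit y → Unit (x * y)
  Unit-* x-unit y-unit = [ x-unit , y-unit ]′ ∘ euclid

  Unit-^ : ∀ {x} k → Unit x → Unit (x ^ k)
  Unit-^ zero    _      = p∤1
  Unit-^ (suc k) x-unit = Unit-* x-unit (Unit-^ k x-unit)

  invertible⇒Unit : ∀ {x y} → x * y ≈ 1ℤ → Unit x
  invertible⇒Unit {x} {y} xy≈1 p∣x = p∤1 (p∣-resp xy≈1 (∣m⇒∣m*n y p∣x))

  Unit⇒≉0 : ∀ {x} → Unit x → ¬ x ≈ 0ℤ
  Unit⇒≉0 x-unit x≈0 = x-unit (p∣-resp (≈-sym x≈0) (divides 0ℤ refl))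

  Unit⇒coprime : ∀ {u} → Unit (+ u) → Coprime u N
  Unit⇒coprime {u} u-unit (d∣u , d∣N) = u⊥p (d∣u , coprime-divisor d⊥p d∣N)
    where
    u⊥p : Coprime u p
    u⊥p (d∣u , d∣p) with prime⇒irreducible p-prime d∣p
    ... | inj₁ d≡1  = d≡1
    ... | inj₂ refl = ⊥-elim (u-unit (∣ᵤ⇒∣ d∣u))
    d⊥p : Coprime _ p
    d⊥p (e∣d , e∣p) = u⊥p (ℕ.∣-trans e∣d d∣u , e∣p)

  NonzeroMultiple : ℤ → Set
  NonzeroMultiple x = + p ∣ x × ¬ x ≈ 0ℤ

  NonzeroMultiple-resp : ∀ {x y} → x ≈ y → NonzeroMultiple x → NonzeroMultiple y
  NonzeroMultiple-resp x≈y (p∣x , x≉0) = p∣-resp x≈y p∣x , x≉0 ∘ ≈-trans x≈y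

  NonzeroMultiple-neg : ∀ {x} → NonzeroMultiple x → NonzeroMultiple (- x)
  NonzeroMultiple-neg (p∣x , x≉0) = ∣m⇒∣-m p∣x , x≉0 ∘ -‿injective {y = 0ℤ}

  NonzeroMultiple-resp± : ∀ {x y} → x ≈± y → NonzeroMultiple x → NonzeroMultiple y
  NonzeroMultiple-resp± (inj₁ x≈y)  = NonzeroMultiple-resp x≈y
  NonzeroMultiple-resp± (inj₂ x≈-y) = NonzeroMultiple-resp (≈-sym (≈-neg-swap x≈-y)) ∘ NonzeroMultiple-neg

  Unit-or-NonzeroMultiple : ∀ {x} → ¬ x ≈ 0ℤ → Unit x ⊎ NonzeroMultiple x
  Unit-or-NonzeroMultiple {x} x≉0 with + p ∣? x
  ... | yes p∣x = inj₂ (p∣x , x≉0)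
  ... | no  p∤x = inj₁ p∤x

  Unit⇒%≢0 : ∀ {z} → Unit (+ z) → z % p ≢ 0
  Unit⇒%≢0 {z} z-unit z%p≡0 = z-unit (∣ᵤ⇒∣ (ℕ.m%n≡0⇒n∣m z p z%p≡0))

  -- A unit z < p² has base-p digits z / p < p and 0 < z % p < p; they are packed into
  -- (z / p) (p − 1) + (z % p − 1) < p (p − 1).
  unit-index unit-element : ℕ → ℕ
  unit-index z   = z ℕ./ p ℕ.* p-1 ℕ.+ (z % p ∸ 1)
  unit-element i = i ℕ./ p-1 ℕ.* p ℕ.+ suc (i % p-1)

  unit-digit-< : ∀ {z} → Unit (+ z) → z % p ∸ 1 ℕ.< p-1
  unit-digit-< {z} z-unit =
    ℕ.s≤s⁻¹ (subst (ℕ._< p) (sym (ℕ.suc-pred (z % p) {{ℕ.≢-nonZero (Unit⇒%≢0 z-unit)}})) (m%n<n z p))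

  unit-element-digit-< : ∀ i → suc (i % p-1) ℕ.< p
  unit-element-digit-< i = ℕ.s≤s (m%n<n i p-1)

  unit-index-< : ∀ {z} → z ℕ.< N → Unit (+ z) → unit-index z ℕ.< p ℕ.* p-1
  unit-index-< {z} z<N z-unit = digits-< (m<n*o⇒m/o<n {z} {p} {p} z<N) (unit-digit-< z-unit)

  unit-element-< : ∀ {i} → i ℕ.< p ℕ.* p-1 → unit-element i ℕ.< N
  unit-element-< {i} i<p*p-1 = digits-< (m<n*o⇒m/o<n {i} {p} {p-1} i<p*p-1) (unit-element-digit-< i)

  unit-element-Unit : ∀ i → Unit (+ unit-element i)
  unit-element-Unit i p∣e =
    ℕ.<⇒≱ (unit-element-digit-< i) (ℕ.∣⇒≤ (ℕ.∣m+n∣m⇒∣n (∣⇒∣ᵤ p∣e) (ℕ.n∣m*n (i ℕ./ p-1))))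

  unit-element-index : ∀ {z} → Unit (+ z) → unit-element (unit-index z) ≡ z
  unit-element-index {z} z-unit = begin
    unit-element (unit-index z)          ≡⟨ cong₂ (λ a b → a ℕ.* p ℕ.+ suc b)
                                              ([a*d+b]/d≡a (z ℕ./ p) p-1 (unit-digit-< z-unit))
                                              ([a*d+b]%d≡b (z ℕ./ p) p-1 (unit-digit-< z-unit)) ⟩
    z ℕ./ p ℕ.* p ℕ.+ suc (z % p ∸ 1)     ≡⟨ cong (z ℕ./ p ℕ.* p ℕ.+_)
                                              (ℕ.suc-pred (z % p) {{ℕ.≢-nonZero (Unit⇒%≢0 z-unit)}}) ⟩
    z ℕ./ p ℕ.* p ℕ.+ z % p               ≡⟨ ℕ.+-comm (z ℕ./ p ℕ.* p) (z % p) ⟩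
    z % p ℕ.+ z ℕ./ p ℕ.* p               ≡⟨ m≡m%n+[m/n]*n z p ⟨
    z                                    ∎
    where open ≡-Reasoning

  unit-index-element : ∀ i → unit-index (unit-element i) ≡ i
  unit-index-element i = begin
    unit-index (unit-element i)       ≡⟨ cong₂ (λ a b → a ℕ.* p-1 ℕ.+ (b ∸ 1))
                                           ([a*d+b]/d≡a (i ℕ./ p-1) p (unit-element-digit-< i))
                                           ([a*d+b]%d≡b (i ℕ./ p-1) p (unit-element-digit-< i)) ⟩
    i ℕ./ p-1 ℕ.* p-1 ℕ.+ i % p-1     ≡⟨ ℕ.+-comm (i ℕ./ p-1 ℕ.* p-1) (i % p-1) ⟩
    i % p-1 ℕ.+ i ℕ./ p-1 ℕ.* p-1     ≡⟨ m≡m%n+[m/n]*n i p-1 ⟨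
    i                                 ∎
    where open ≡-Reasoning

  unit-enumeration : Enumeration N Unit (p ℕ.* p-1)
  unit-enumeration = record
    { index             = λ z z<N z-unit → fromℕ< (unit-index-< z<N z-unit)
    ; element           = unit-element ∘ toℕ
    ; element-<         = unit-element-< ∘ toℕ<n
    ; element-∈         = unit-element-Unit ∘ toℕ
    ; element-index     = λ z z<N z-unit →
        trans (cong unit-element (toℕ-fromℕ< (unit-index-< z<N z-unit))) (unit-element-index z-unit)
    ; element-injective = λ {i} {j} e≡ → toℕ-injective
        (trans (sym (unit-index-element (toℕ i))) (trans (cong unit-index e≡) (unit-index-element (toℕ j))))
    }

  multiple-index multiple-element : ℕ → ℕ
  multiple-index z   = z ℕ./ p ∸ 1
  multiple-element i = suc i ℕ.* p

  multiple-quotient≢0 : ∀ {z} → NonzeroMultiple (+ z) → z ℕ./ p ≢ 0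
  multiple-quotient≢0 {z} (p∣z , z≉0) z/p≡0 =
    z≉0 (≈-reflexive (cong +_ (trans (sym (m/n*n≡m (∣⇒∣ᵤ p∣z))) (cong (ℕ._* p) z/p≡0))))

  multiple-index-< : ∀ {z} → z ℕ.< N → NonzeroMultiple (+ z) → multiple-index z ℕ.< p-1
  multiple-index-< {z} z<N z-mult = ℕ.s≤s⁻¹ (subst (ℕ._< p)
    (sym (ℕ.suc-pred (z ℕ./ p) {{ℕ.≢-nonZero (multiple-quotient≢0 z-mult)}})) (m<n*o⇒m/o<n {z} {p} {p} z<N))

  multiple-element-< : ∀ {i} → i ℕ.< p-1 → multiple-element i ℕ.< N
  multiple-element-< i<p-1 = ℕ.*-monoˡ-< p (ℕ.s≤s i<p-1)

  multiple-element-NonzeroMultiple : ∀ {i} → i ℕ.< p-1 → NonzeroMultiple (+ multiple-element i)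
  multiple-element-NonzeroMultiple {i} i<p-1 =
    ∣ᵤ⇒∣ (ℕ.n∣m*n (suc i)) , λ e≈0 → case ≈-<-injective (multiple-element-< i<p-1) ℕ.z<s e≈0 of λ ()

  multiple-element-index : ∀ {z} → NonzeroMultiple (+ z) → multiple-element (multiple-index z) ≡ z
  multiple-element-index {z} z-mult@(p∣z , _) =
    trans (cong (ℕ._* p) (ℕ.suc-pred (z ℕ./ p) {{ℕ.≢-nonZero (multiple-quotient≢0 z-mult)}}))
          (m/n*n≡m (∣⇒∣ᵤ p∣z))

  multiple-enumeration : Enumeration N NonzeroMultiple p-1
  multiple-enumeration = record
    { index             = λ z z<N z-mult → fromℕ< (multiple-index-< z<N z-mult)
    ; element           = multiple-element ∘ toℕ
    ; element-<         = multiple-element-< ∘ toℕ<n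
    ; element-∈         = multiple-element-NonzeroMultiple ∘ toℕ<n
    ; element-index     = λ z z<N z-mult →
        trans (cong multiple-element (toℕ-fromℕ< (multiple-index-< z<N z-mult))) (multiple-element-index z-mult)
    ; element-injective = λ {i} {j} e≡ →
        toℕ-injective (ℕ.suc-injective (ℕ.*-cancelʳ-≡ (suc (toℕ i)) (suc (toℕ j)) p e≡))
    }

  multiple-cofactor : ∀ {z} → z ℕ.< N → NonzeroMultiple (+ z) →
                      Σ ℕ λ w → w ℕ.< N × Unit (+ w) × + z ≡ + p * + w
  multiple-cofactor {z} z<N (p∣z , z≉0) = w , w<N , z≉0 ∘ ≈-trans (≈-reflexive z≡pw) ∘ p∣⇒p*≈0 , z≡pw
    where
    w = z ℕ./ p
    w<N : w ℕ.< N
    w<N = ℕ.<-≤-trans (m<n*o⇒m/o<n {z} {p} {p} z<N) (ℕ.m≤m*n p p)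
    z≡pw : + z ≡ + p * + w
    z≡pw = trans (cong +_ (trans (sym (m/n*n≡m (∣⇒∣ᵤ p∣z))) (ℕ.*-comm w p))) (ℤ.pos-* p w)

  multiple-orbit-complete : ∀ {θ} → (∀ w → w ℕ.< N → Unit (+ w) → ∃ λ k → + w ≈± 1ℤ * θ ^ k) →
                            ∀ z → z ℕ.< N → NonzeroMultiple (+ z) → ∃ λ k → + z ≈± + p * θ ^ k
  multiple-orbit-complete {θ} unit-orbit-complete z z<N z-mult =
    let w , w<N , w-unit , z≡pw = multiple-cofactor z<N z-mult
        k , w≈±θ^k = unit-orbit-complete w w<N w-unit
    in k , subst₂ _≈±_ (sym z≡pw) (cong (+ p *_) (ℤ.*-identityˡ (θ ^ k))) (*-congˡ-≈± (+ p) w≈±θ^k)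

module PPS-8t+7
  (t : ℕ) (p-prime : Prime (7 ℕ.+ t ℕ.* 8)) (s : ℕ)
  (s²≡2 : ZMod._≡ₘ_ ((7 ℕ.+ t ℕ.* 8) ℕ.* (7 ℕ.+ t ℕ.* 8))
            (ZMod._*ₘ_ ((7 ℕ.+ t ℕ.* 8) ℕ.* (7 ℕ.+ t ℕ.* 8)) s s) 2)
  (generates : ZMod.GeneratesModSign ((7 ℕ.+ t ℕ.* 8) ℕ.* (7 ℕ.+ t ℕ.* 8))
                 (ZMod._+ₘ_ ((7 ℕ.+ t ℕ.* 8) ℕ.* (7 ℕ.+ t ℕ.* 8)) 1 s))
  where

  open PrimeSquare (5 ℕ.+ t ℕ.* 8) p-prime
  open Congruence N
  open Residues N
  open PairSystems N
  open Cardinality N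
  open ZMod N using (_*ₘ_; _+ₘ_; ±⟨_,_⟩; PPS; card)

  s²≈2 : + s * + s ≈ + 2
  s²≈2 = ≈-trans (≈-reflexive (sym (ℤ.pos-* s s))) (≈-trans (≈-sym (mod-≈ (s ℕ.* s))) (≡ₘ⇒≈ s²≡2))

  open SilverRatio N (+ s) s²≈2

  -- With p = 8t + 7: half = (p² + 1)/2, and the orbit periods are m₁ = p(p − 1)/2 = 2L₁ + 1 and
  -- m₂ = (p − 1)/2 = 2L₂ + 1. The t-terms come first so that these constants do not unfold
  -- into long chains of suc (which would make θ ^ mᵢ expensive to normalise).
  half L₁ L₂ : ℕ
  half = t ℕ.* t ℕ.* 32 ℕ.+ t ℕ.* 56 ℕ.+ 25
  L₁   = t ℕ.* t ℕ.* 16 ℕ.+ t ℕ.* 26 ℕ.+ 10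
  L₂   = t ℕ.* 2 ℕ.+ 1

  2*half≈1 : + 2 * + half ≈ 1ℤ
  2*half≈1 = ≈-trans (≈-reflexive (trans (sym (ℤ.pos-* 2 half)) (cong +_ (2*half≡1+N t)))) (+-multiple≈ 1ℤ 1ℤ)
    where
    2*half≡1+N : ∀ t → 2 ℕ.* (t ℕ.* t ℕ.* 32 ℕ.+ t ℕ.* 56 ℕ.+ 25) ≡
                       1 ℕ.+ 1 ℕ.* ((7 ℕ.+ t ℕ.* 8) ℕ.* (7 ℕ.+ t ℕ.* 8))
    2*half≡1+N = ℕ-solve-∀

  ≉0⇒¬self-negative : ∀ {x} → ¬ x ≈ 0ℤ → ¬ x ≈ - x
  ≉0⇒¬self-negative x≉0 = x≉0 ∘ self-negative⇒≈0 {+ half} 2*half≈1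

  θ-Unit : Unit θ
  θ-Unit = invertible⇒Unit θθ⁻¹≈1

  θ^k-Unit : ∀ k → Unit (1ℤ * θ ^ k)
  θ^k-Unit k = Unit-* p∤1 (Unit-^ k θ-Unit)

  pθ^k-NonzeroMultiple : ∀ k → NonzeroMultiple (+ p * θ ^ k)
  pθ^k-NonzeroMultiple k = ∣m⇒∣m*n (θ ^ k) ∣-refl , Unit-^ k θ-Unit ∘ p*≈0⇒p∣

  θℕ^k≈θ^k : ∀ k → + ((1 +ₘ s) ℕ.^ k) ≈ 1ℤ * θ ^ k
  θℕ^k≈θ^k k = begin
    + ((1 +ₘ s) ℕ.^ k)   ≡⟨ pos-^ (1 +ₘ s) k ⟩
    (+ (1 +ₘ s)) ^ k     ≈⟨ ^-cong k (+ₘ-≈ 1 s) ⟩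
    θ ^ k                ≡⟨ ℤ.*-identityˡ (θ ^ k) ⟨
    1ℤ * θ ^ k           ∎
    where open ≈-Reasoning

  unit-orbit-complete : ∀ z → z ℕ.< N → Unit (+ z) → ∃ λ k → + z ≈± 1ℤ * θ ^ k
  unit-orbit-complete z z<N z-unit with generates z z<N (Unit⇒coprime z-unit)
  ... | k , inj₁ θ^k≡z  = k , inj₁ (≈-trans (≈-sym (≡ₘ⇒≈ θ^k≡z)) (θℕ^k≈θ^k k))
  ... | k , inj₂ θ^k≡-z =
    k , inj₂ (≈-neg-swap (≈-trans (≈-sym (θℕ^k≈θ^k k)) (≈-trans (≡ₘ⇒≈ θ^k≡-z) (negₘ-≈ z))))

  units-count : ∀ t → let L = t ℕ.* t ℕ.* 16 ℕ.+ t ℕ.* 26 ℕ.+ 10 in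
                (7 ℕ.+ t ℕ.* 8) ℕ.* (6 ℕ.+ t ℕ.* 8) ≡ suc (L ℕ.+ L) ℕ.+ suc (L ℕ.+ L)
  units-count = ℕ-solve-∀

  multiples-count : ∀ t → let L = t ℕ.* 2 ℕ.+ 1 in 6 ℕ.+ t ℕ.* 8 ≡ suc (L ℕ.+ L) ℕ.+ suc (L ℕ.+ L)
  multiples-count = ℕ-solve-∀

  module Units = OrderUpToSign N Unit Unit-resp Unit-neg (≉0⇒¬self-negative ∘ Unit⇒≉0) (suc (L₁ ℕ.+ L₁))
    (subst (Enumeration N Unit) (units-count t) unit-enumeration) 1ℤ θ θ⁻¹ θθ⁻¹≈1 θ^k-Unit unit-orbit-complete

  module Multiples = OrderUpToSign N NonzeroMultiple NonzeroMultiple-resp NonzeroMultiple-neg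
    (≉0⇒¬self-negative ∘ proj₂) (suc (L₂ ℕ.+ L₂))
    (subst (Enumeration N NonzeroMultiple) (multiples-count t) multiple-enumeration)
    (+ p) θ θ⁻¹ θθ⁻¹≈1 pθ^k-NonzeroMultiple (multiple-orbit-complete unit-orbit-complete)

  module UnitPairs     = OrbitPairs N 1ℤ θ θ⁻¹ θθ⁻¹≈1 L₁ Units.period
  module MultiplePairs = OrbitPairs N (+ p) θ θ⁻¹ θθ⁻¹≈1 L₂ Multiples.period

  S : List (ℕ × ℕ)
  S = UnitPairs.pairs ++ MultiplePairs.pairs

  covered-unless-excluded : ∀ {z} → ¬ Excluded 1ℤ (+ p) z → ±-Covered S z
  covered-unless-excluded {z} z∉A = [ via-units , via-multiples ]′ (Unit-or-NonzeroMultiple (z∉A ∘ inj₁))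
    where
    via-units : Unit z → ±-Covered S z
    via-units z-unit =
      let k , z≈±θ^k = Units.orbit-complete-ℤ z-unit
      in [ (λ z≈±1 → ⊥-elim (z∉A (inj₂ (inj₁ z≈±1)))) , Any.++⁺ˡ ]′ (UnitPairs.orbit-covered k z≈±θ^k)
    via-multiples : NonzeroMultiple z → ±-Covered S z
    via-multiples z-mult =
      let k , z≈±pθ^k = Multiples.orbit-complete-ℤ z-mult
      in [ (λ z≈±p → ⊥-elim (z∉A (inj₂ (inj₂ z≈±p)))) , Any.++⁺ʳ UnitPairs.pairs ]′
           (MultiplePairs.orbit-covered k z≈±pθ^k)

  unit-pair-not-excluded : ∀ {z} → ±-Covered UnitPairs.pairs z → ¬ Excluded 1ℤ (+ p) z
  unit-pair-not-excluded z∈pairs =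
    let k , 0<k , k<m , z≈±θ^k = UnitPairs.covered-exponent z∈pairs
        z-unit = Unit-resp± (≈±-sym z≈±θ^k) (θ^k-Unit k)
    in λ { (inj₁ z≈0)         → Unit⇒≉0 z-unit z≈0
         ; (inj₂ (inj₁ z≈±1)) → Units.aperiodic k<m (0<k , ≈±-trans (≈±-sym z≈±θ^k) z≈±1)
         ; (inj₂ (inj₂ z≈±p)) → z-unit (p∣-resp± (≈±-sym z≈±p) ∣-refl)
         }

  multiple-pair-not-excluded : ∀ {z} → ±-Covered MultiplePairs.pairs z → ¬ Excluded 1ℤ (+ p) z
  multiple-pair-not-excluded z∈pairs =
    let k , 0<k , k<m , z≈±pθ^k = MultiplePairs.covered-exponent z∈pairs
        p∣z , z≉0 = NonzeroMultiple-resp± (≈±-sym z≈±pθ^k) (pθ^k-NonzeroMultiple k)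
    in λ { (inj₁ z≈0)         → z≉0 z≈0
         ; (inj₂ (inj₁ z≈±1)) → p∤1 (p∣-resp± z≈±1 p∣z)
         ; (inj₂ (inj₂ z≈±p)) → Multiples.aperiodic k<m (0<k , ≈±-trans (≈±-sym z≈±pθ^k) z≈±p)
         }

  ±-complement : ±-Covered S IsComplementOf Excluded 1ℤ (+ p)
  ±-complement z =
    covered-unless-excluded , [ unit-pair-not-excluded , multiple-pair-not-excluded ]′ ∘ Any.++⁻ UnitPairs.pairs

  s⁻¹ : ℤ
  s⁻¹ = + s * + half

  ss⁻¹≈1 : + s * s⁻¹ ≈ 1ℤ
  ss⁻¹≈1 = ≈-trans (≈-reflexive (sym (ℤ.*-assoc (+ s) (+ s) (+ half))))
                   (≈-trans (*-cong s²≈2 (≈-refl {+ half})) 2*half≈1)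

  p*ₘs≈ : + (p *ₘ s) ≈ + p * + s
  p*ₘs≈ = ≈-trans (mod-≈ (p ℕ.* s)) (≈-reflexive (ℤ.pos-* p s))

  ∓-complement : ∓-Covered S IsComplementOf Excluded (+ s) (+ (p *ₘ s))
  ∓-complement = Scaling.scale-complement (+ s) s⁻¹ ss⁻¹≈1 (All.++⁺
      (All.map⁺ (All.universal (λ i → consecutive-DiffSumScaled 1ℤ (suc (i ℕ.+ i))) (upTo L₁)))
      (All.map⁺ (All.universal (λ i → consecutive-DiffSumScaled (+ p) (suc (i ℕ.+ i))) (upTo L₂))))
    (≈±-reflexive (sym (ℤ.*-identityʳ (+ s)))) (inj₁ (≈-trans p*ₘs≈ (≈-reflexive (ℤ.*-comm (+ p) (+ s)))))
    ±-complement

  card-excluded-unit : ∀ {u a b} → Unit u → + a ≈ u → + b ≈ + p * u → card (0 ∷ ±⟨ a , b ⟩) ≡ 5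
  card-excluded-unit {u} u-unit a≈u b≈pu =
    card-excluded a≉0 b≉0 (≉0⇒¬self-negative a≉0) (≉0⇒¬self-negative b≉0)
      (λ a≈±b → a-unit (p∣-resp± (≈±-sym a≈±b) p∣b))
    where
    a-unit = Unit-resp (≈-sym a≈u) u-unit
    a≉0 = Unit⇒≉0 a-unit
    b≉0 = u-unit ∘ p*≈0⇒p∣ ∘ ≈-trans (≈-sym b≈pu)
    p∣b = p∣-resp (≈-sym b≈pu) (∣m⇒∣m*n u ∣-refl)

  card-A₁ : card (0 ∷ ±⟨ 1 , p ⟩) ≡ 5
  card-A₁ = card-excluded-unit p∤1 ≈-refl (≈-reflexive (sym (ℤ.*-identityʳ (+ p))))

  card-A₂ : card (0 ∷ ±⟨ s , p *ₘ s ⟩) ≡ 5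
  card-A₂ = card-excluded-unit {a = s} (invertible⇒Unit {y = s⁻¹} ss⁻¹≈1) ≈-refl p*ₘs≈

  size : 4 ℕ.* length S ℕ.+ card (0 ∷ ±⟨ 1 , p ⟩) ≡ N
  size = begin
    4 ℕ.* length S ℕ.+ card (0 ∷ ±⟨ 1 , p ⟩)  ≡⟨ cong₂ (λ l c → 4 ℕ.* l ℕ.+ c) length-S card-A₁ ⟩
    4 ℕ.* (L₁ ℕ.+ L₂) ℕ.+ 5                     ≡⟨ arithmetic t ⟩
    N                                           ∎
    where
    open ≡-Reasoning
    length-S : length S ≡ L₁ ℕ.+ L₂
    length-S = trans (List.length-++ UnitPairs.pairs) (cong₂ ℕ._+_ UnitPairs.length-pairs MultiplePairs.length-pairs)
    arithmetic : ∀ t → 4 ℕ.* ((t ℕ.* t ℕ.* 16 ℕ.+ t ℕ.* 26 ℕ.+ 10) ℕ.+ (t ℕ.* 2 ℕ.+ 1)) ℕ.+ 5 ≡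
                       (7 ℕ.+ t ℕ.* 8) ℕ.* (7 ℕ.+ t ℕ.* 8)
    arithmetic = ℕ-solve-∀

  pps : PPS (0 ∷ ±⟨ 1 , p ⟩) (0 ∷ ±⟨ s , p *ₘ s ⟩)
  pps = PPS-intro S (trans card-A₁ (sym card-A₂)) size
    (All.++⁺ UnitPairs.pairs-bounded MultiplePairs.pairs-bounded) ±-complement ∓-complement

≡7-mod-8 : ∀ {p} → p % 8 ≡ 7 → ∃ λ t → p ≡ 7 ℕ.+ t ℕ.* 8
≡7-mod-8 {p} p%8≡7 = p ℕ./ 8 , trans (m≡m%n+[m/n]*n p 8) (cong (ℕ._+ p ℕ./ 8 ℕ.* 8) p%8≡7)

lemma6p7 : (p : ℕ) → Prime p → p % 8 ≡ 7 →
    (s : ℕ) → s ℕ.< p ℕ.* p → ZMod._≡ₘ_ (p ℕ.* p) (ZMod._*ₘ_ (p ℕ.* p) s s) 2 →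
    ZMod.GeneratesModSign (p ℕ.* p) (ZMod._+ₘ_ (p ℕ.* p) 1 s) →
    ZMod.PPS (p ℕ.* p)
    (0 ∷ 1 ∷ ZMod.negₘ (p ℕ.* p) 1 ∷ p ∷ ZMod.negₘ (p ℕ.* p) p ∷ [])
    (0 ∷ s ∷ ZMod.negₘ (p ℕ.* p) s ∷ ZMod._*ₘ_ (p ℕ.* p) p s
    ∷ ZMod.negₘ (p ℕ.* p) (ZMod._*ₘ_ (p ℕ.* p) p s) ∷ [])
lemma6p7 p p-prime p%8≡7 s _ s²≡2 generates with ≡7-mod-8 {p} p%8≡7
... | t , refl = PPS-8t+7.pps t p-prime s s²≡2 generates
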